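{- $W(10,3) > 701$; that is, there exists a coloring of $\{1,2,\dots,701\}$ with $10$ colors containing no monochromatic arithmetic progression of length $3$.
   Context: For positive integers $r$ and $k$, the van der Waerden number $W(r,k)$ is the smallest positive integer $N$ such that for every coloring of the integers $\{1,2,\dots,N\}$ with $r$ colors there exist $k$ integers in arithmetic progression (with nonzero common difference) all of the same color. (Its existence is van der Waerden's theorem.) -}

module Defs where

open import Data.Nat using (ℕ; suc; _+_; _*_; _≤_; _<_)
open import Data.Fin using (Fin)
open import Data.Product using (Σ; ∃; _×_)
open import Relation.Binary.PropositionalEquality using (_≡_)
open import Relation.Nullary using (¬_)

-- An r-colouring of {1,…,N}: we use functions on all of ℕ, only values
-- at 1..N matter (every colouring of {1..N} extends to one).
Colouring : ℕ → Set
Colouring r = ℕ → Fin r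

HasMonoAP : (r k N : ℕ) → Colouring r → Set
HasMonoAP r k N c =
  Σ ℕ λ a → Σ ℕ λ d →
    (1 ≤ a) × (1 ≤ d) × (∀ i → i < k → a + i * d ≤ N) ×
    (∀ i → i < k → c (a + i * d) ≡ c a)

-- W(r,k) is the least such N, so
-- W(r,k) > N  iff  ¬ VdWProperty r k N (the property is upward closed).
VdWProperty : (r k N : ℕ) → Set
VdWProperty r k N = (c : Colouring r) → HasMonoAP r k N c

-- An explicit 10-colouring of {1,…,701} is checked by evaluation.  For each gap d the triples (c i, c (i + d), c (i + 2d)) are
-- read off by zipping the colour list with its shifts by d and 2d, so a gap
-- costs time linear in the length of the list rather than a lookup per term.
module Submission where

open import Data.Fin using (Fin; zero)
open import Data.Fin.Properties using (_≟_)
open import Data.List using (List; []; _∷_; length; drop; head; zip)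
open import Data.List.Properties using (drop-drop)
open import Data.List.Relation.Unary.All using (All; _∷_; all?)
open import Data.Maybe using (just; fromMaybe)
open import Data.Nat using (ℕ; zero; suc; _+_; _*_; _∸_; _<_; s≤s; z<s; s<s)
open import Data.Nat.Properties using (+-comm; *-identityˡ; ≤-trans; m≤m+n; m≤n+m; allUpTo?)
open import Data.Product using (Σ; _×_; _,_)
open import Data.Fin.Literals using (number)
open import Relation.Binary.Definitions using (DecidableEquality)
open import Relation.Binary.PropositionalEquality using (_≡_; refl; cong; subst; module ≡-Reasoning)
open import Relation.Nullary using (¬_; Dec; ¬?)
open import Relation.Nullary.Decidable using (_×-dec_; toWitness)

open import Defs

private
  variable
    A B : Set
    r : ℕ

head-drop-zip : ∀ {xs : List A} {ys : List B} i {x y} →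
                head (drop i xs) ≡ just x → head (drop i ys) ≡ just y →
                head (drop i (zip xs ys)) ≡ just (x , y)
head-drop-zip {xs = _ ∷ _}  {_ ∷ _}  zero    refl refl = refl
head-drop-zip {xs = _ ∷ xs} {_ ∷ ys} (suc i) hx   hy   = head-drop-zip {xs = xs} {ys} i hx hy

All-head-drop : ∀ {P : A → Set} {xs} i {x} → All P xs → head (drop i xs) ≡ just x → P x
All-head-drop zero    (px ∷ _)   refl = px
All-head-drop (suc i) (_  ∷ pxs) hx   = All-head-drop i pxs hx

-- Point x is coloured by entry x ∸ 1 of the list; points beyond it get colour zero.
listColouring : List (Fin (suc r)) → Colouring (suc r)
listColouring cs x = fromMaybe zero (head (drop (x ∸ 1) cs))

head-drop-listColouring : ∀ (cs : List (Fin (suc r))) {p} → p < length cs →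
                          head (drop p cs) ≡ just (listColouring cs (suc p))
head-drop-listColouring (_ ∷ _)  {zero}  _         = refl
head-drop-listColouring (_ ∷ cs) {suc p} (s≤s p<n) = head-drop-listColouring cs p<n

arithmeticTriples : ℕ → List A → List (A × A × A)
arithmeticTriples d xs = zip xs (zip (drop d xs) (drop (2 * d) xs))

Monochromatic : A × A × A → Set
Monochromatic (x , y , z) = x ≡ y × x ≡ z

NoMonochromaticTriple : ℕ → List A → Set
NoMonochromaticTriple d xs = All (λ t → ¬ Monochromatic t) (arithmeticTriples d xs)

noMonochromaticTriple? : DecidableEquality A → ∀ d (xs : List A) → Dec (NoMonochromaticTriple d xs)
noMonochromaticTriple? _≟_ d xs =
  all? (λ { (x , y , z) → ¬? ((x ≟ y) ×-dec (x ≟ z)) }) (arithmeticTriples d xs)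

noMonoAP-listColouring : (cs : List (Fin (suc r))) →
                         (∀ {d} → d < length cs → NoMonochromaticTriple (suc d) cs) →
                         ¬ HasMonoAP (suc r) 3 (length cs) (listColouring cs)
noMonoAP-listColouring {r} cs free (suc p , suc d , _ , _ , inRange , mono) =
  All-head-drop p (free d<length) triple (refl , refl)
  where
  c : Colouring (suc r)
  c = listColouring cs

  d<length : d < length cs
  d<length = ≤-trans (m≤m+n (suc d) 0) (≤-trans (m≤n+m _ (suc p)) (inRange 1 (s<s z<s)))

  term : ∀ i → i < 3 → head (drop p (drop (i * suc d) cs)) ≡ just (c (suc p))
  term i i<3 = begin
    head (drop p (drop k cs))   ≡⟨ cong head (drop-drop k p cs) ⟩
    head (drop (k + p) cs)      ≡⟨ cong (λ n → head (drop n cs)) (+-comm k p) ⟩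
    head (drop (p + k) cs)      ≡⟨ head-drop-listColouring cs (inRange i i<3) ⟩
    just (c (suc p + k))        ≡⟨ cong just (mono i i<3) ⟩
    just (c (suc p))            ∎
    where
    open ≡-Reasoning
    k : ℕ
    k = i * suc d

  term₁ : head (drop p (drop (suc d) cs)) ≡ just (c (suc p))
  term₁ = subst (λ k → head (drop p (drop k cs)) ≡ just (c (suc p)))
                (*-identityˡ (suc d)) (term 1 (s<s z<s))

  triple : head (drop p (arithmeticTriples (suc d) cs)) ≡ just (c (suc p) , c (suc p) , c (suc p))
  triple = head-drop-zip p (term 0 z<s) (head-drop-zip p term₁ (term 2 (s<s (s<s z<s))))

Colour : Set
Colour = Fin 10

colours : List Colour
colours =
  5 ∷ 5 ∷ 8 ∷ 7 ∷ 1 ∷ 7 ∷ 2 ∷ 1 ∷ 3 ∷ 5 ∷ 6 ∷ 4 ∷ 3 ∷ 7 ∷ 9 ∷ 9 ∷ 8 ∷ 7 ∷ 7 ∷ 9 ∷ 8 ∷ 0 ∷ 8 ∷ 4 ∷ 2 ∷ 4 ∷ 2 ∷ 5 ∷ 4 ∷ 4 ∷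
  3 ∷ 6 ∷ 1 ∷ 2 ∷ 8 ∷ 3 ∷ 2 ∷ 3 ∷ 7 ∷ 6 ∷ 1 ∷ 3 ∷ 6 ∷ 3 ∷ 2 ∷ 1 ∷ 6 ∷ 7 ∷ 0 ∷ 0 ∷ 8 ∷ 4 ∷ 4 ∷ 3 ∷ 9 ∷ 8 ∷ 1 ∷ 5 ∷ 9 ∷ 5 ∷
  4 ∷ 3 ∷ 5 ∷ 5 ∷ 1 ∷ 7 ∷ 7 ∷ 9 ∷ 1 ∷ 6 ∷ 9 ∷ 6 ∷ 4 ∷ 0 ∷ 7 ∷ 6 ∷ 2 ∷ 1 ∷ 9 ∷ 2 ∷ 2 ∷ 0 ∷ 8 ∷ 3 ∷ 6 ∷ 5 ∷ 0 ∷ 1 ∷ 5 ∷ 2 ∷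
  3 ∷ 8 ∷ 5 ∷ 8 ∷ 0 ∷ 5 ∷ 3 ∷ 8 ∷ 7 ∷ 4 ∷ 4 ∷ 0 ∷ 7 ∷ 2 ∷ 5 ∷ 7 ∷ 5 ∷ 8 ∷ 9 ∷ 7 ∷ 9 ∷ 7 ∷ 0 ∷ 9 ∷ 9 ∷ 8 ∷ 1 ∷ 1 ∷ 7 ∷ 8 ∷
  8 ∷ 2 ∷ 8 ∷ 7 ∷ 9 ∷ 1 ∷ 3 ∷ 1 ∷ 8 ∷ 2 ∷ 6 ∷ 1 ∷ 4 ∷ 0 ∷ 5 ∷ 8 ∷ 4 ∷ 4 ∷ 8 ∷ 9 ∷ 3 ∷ 1 ∷ 0 ∷ 9 ∷ 0 ∷ 4 ∷ 3 ∷ 5 ∷ 0 ∷ 1 ∷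
  2 ∷ 2 ∷ 4 ∷ 1 ∷ 6 ∷ 9 ∷ 1 ∷ 9 ∷ 5 ∷ 7 ∷ 1 ∷ 2 ∷ 6 ∷ 4 ∷ 2 ∷ 2 ∷ 5 ∷ 3 ∷ 8 ∷ 1 ∷ 0 ∷ 5 ∷ 6 ∷ 0 ∷ 6 ∷ 2 ∷ 3 ∷ 5 ∷ 3 ∷ 5 ∷
  6 ∷ 3 ∷ 3 ∷ 9 ∷ 9 ∷ 4 ∷ 0 ∷ 2 ∷ 7 ∷ 0 ∷ 2 ∷ 5 ∷ 3 ∷ 4 ∷ 2 ∷ 9 ∷ 2 ∷ 0 ∷ 9 ∷ 9 ∷ 3 ∷ 1 ∷ 6 ∷ 7 ∷ 3 ∷ 3 ∷ 7 ∷ 8 ∷ 2 ∷ 4 ∷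
  6 ∷ 8 ∷ 6 ∷ 3 ∷ 7 ∷ 6 ∷ 6 ∷ 4 ∷ 5 ∷ 5 ∷ 3 ∷ 9 ∷ 9 ∷ 8 ∷ 4 ∷ 3 ∷ 6 ∷ 5 ∷ 4 ∷ 0 ∷ 9 ∷ 8 ∷ 0 ∷ 0 ∷ 6 ∷ 7 ∷ 7 ∷ 4 ∷ 6 ∷ 1 ∷
  4 ∷ 1 ∷ 4 ∷ 5 ∷ 2 ∷ 1 ∷ 7 ∷ 6 ∷ 9 ∷ 7 ∷ 7 ∷ 5 ∷ 8 ∷ 3 ∷ 6 ∷ 0 ∷ 0 ∷ 1 ∷ 5 ∷ 6 ∷ 2 ∷ 3 ∷ 0 ∷ 8 ∷ 0 ∷ 1 ∷ 8 ∷ 3 ∷ 2 ∷ 4 ∷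
  9 ∷ 5 ∷ 2 ∷ 2 ∷ 5 ∷ 7 ∷ 0 ∷ 3 ∷ 9 ∷ 7 ∷ 4 ∷ 7 ∷ 5 ∷ 4 ∷ 4 ∷ 8 ∷ 6 ∷ 6 ∷ 2 ∷ 3 ∷ 8 ∷ 7 ∷ 3 ∷ 2 ∷ 9 ∷ 6 ∷ 8 ∷ 1 ∷ 8 ∷ 7 ∷
  1 ∷ 1 ∷ 9 ∷ 5 ∷ 0 ∷ 3 ∷ 9 ∷ 9 ∷ 3 ∷ 4 ∷ 8 ∷ 6 ∷ 0 ∷ 4 ∷ 5 ∷ 9 ∷ 3 ∷ 0 ∷ 5 ∷ 6 ∷ 2 ∷ 2 ∷ 9 ∷ 6 ∷ 1 ∷ 4 ∷ 6 ∷ 9 ∷ 0 ∷ 2 ∷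
  6 ∷ 7 ∷ 1 ∷ 4 ∷ 7 ∷ 7 ∷ 0 ∷ 3 ∷ 8 ∷ 1 ∷ 5 ∷ 0 ∷ 6 ∷ 0 ∷ 1 ∷ 7 ∷ 8 ∷ 0 ∷ 8 ∷ 0 ∷ 1 ∷ 3 ∷ 8 ∷ 2 ∷ 4 ∷ 9 ∷ 5 ∷ 7 ∷ 2 ∷ 0 ∷
  2 ∷ 0 ∷ 8 ∷ 9 ∷ 7 ∷ 4 ∷ 7 ∷ 5 ∷ 4 ∷ 4 ∷ 8 ∷ 6 ∷ 1 ∷ 2 ∷ 8 ∷ 8 ∷ 2 ∷ 3 ∷ 7 ∷ 4 ∷ 1 ∷ 3 ∷ 1 ∷ 8 ∷ 2 ∷ 1 ∷ 1 ∷ 4 ∷ 0 ∷ 0 ∷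
  8 ∷ 4 ∷ 4 ∷ 3 ∷ 9 ∷ 8 ∷ 1 ∷ 0 ∷ 9 ∷ 5 ∷ 4 ∷ 3 ∷ 5 ∷ 5 ∷ 1 ∷ 2 ∷ 2 ∷ 9 ∷ 1 ∷ 6 ∷ 9 ∷ 6 ∷ 9 ∷ 0 ∷ 7 ∷ 6 ∷ 2 ∷ 1 ∷ 4 ∷ 2 ∷
  2 ∷ 0 ∷ 3 ∷ 8 ∷ 1 ∷ 5 ∷ 5 ∷ 6 ∷ 0 ∷ 1 ∷ 7 ∷ 8 ∷ 5 ∷ 3 ∷ 5 ∷ 6 ∷ 8 ∷ 9 ∷ 7 ∷ 9 ∷ 4 ∷ 0 ∷ 7 ∷ 7 ∷ 0 ∷ 2 ∷ 5 ∷ 8 ∷ 4 ∷ 2 ∷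
  9 ∷ 2 ∷ 0 ∷ 9 ∷ 9 ∷ 3 ∷ 1 ∷ 1 ∷ 7 ∷ 8 ∷ 3 ∷ 2 ∷ 8 ∷ 7 ∷ 4 ∷ 1 ∷ 3 ∷ 6 ∷ 3 ∷ 2 ∷ 6 ∷ 6 ∷ 4 ∷ 0 ∷ 5 ∷ 8 ∷ 4 ∷ 4 ∷ 8 ∷ 9 ∷
  3 ∷ 1 ∷ 5 ∷ 9 ∷ 0 ∷ 4 ∷ 8 ∷ 5 ∷ 0 ∷ 1 ∷ 7 ∷ 7 ∷ 4 ∷ 1 ∷ 6 ∷ 9 ∷ 1 ∷ 4 ∷ 5 ∷ 7 ∷ 1 ∷ 2 ∷ 6 ∷ 9 ∷ 2 ∷ 2 ∷ 5 ∷ 8 ∷ 3 ∷ 6 ∷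
  0 ∷ 0 ∷ 1 ∷ 5 ∷ 6 ∷ 2 ∷ 3 ∷ 5 ∷ 8 ∷ 0 ∷ 6 ∷ 8 ∷ 8 ∷ 7 ∷ 4 ∷ 4 ∷ 0 ∷ 2 ∷ 2 ∷ 5 ∷ 7 ∷ 5 ∷ 3 ∷ 9 ∷ 7 ∷ 9 ∷ 7 ∷ 0 ∷ 9 ∷ 9 ∷
  8 ∷ 1 ∷ 6 ∷ 7 ∷ 3 ∷ 8 ∷ 7 ∷ 8 ∷ 2 ∷ 9 ∷ 6 ∷ 8 ∷ 1 ∷ 8 ∷ 7 ∷ 6 ∷ 1 ∷ 9 ∷ 5 ∷ 5 ∷ 3 ∷ 9 ∷ 9 ∷ 8 ∷ 4 ∷ 3 ∷ 6 ∷ 0 ∷ 4 ∷ 0 ∷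
  9 ∷ 8 ∷ 0 ∷ 0 ∷ 6 ∷ 2 ∷ 2 ∷ 4 ∷ 6 ∷ 1 ∷ 4 ∷ 1 ∷ 9 ∷ 5 ∷ 2 ∷ 1 ∷ 7 ∷ 6 ∷ 4 ∷ 7 ∷ 7 ∷ 5 ∷ 3 ∷ 8 ∷ 1 ∷ 0 ∷ 5 ∷ 6 ∷ 0 ∷ 1 ∷
  7 ∷ 3 ∷ 0 ∷ 3 ∷ 5 ∷ 1 ∷ 7 ∷ 3 ∷ 2 ∷ 9 ∷ 9 ∷ 5 ∷ 2 ∷ 7 ∷ 0 ∷ 2 ∷ 0 ∷ 3 ∷ 4 ∷ 2 ∷ 4 ∷ 2 ∷ 5 ∷ 4 ∷ 4 ∷ 3 ∷ 6 ∷ 6 ∷ 2 ∷ 3 ∷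
  3 ∷ 7 ∷ 3 ∷ 2 ∷ 4 ∷ 6 ∷ 8 ∷ 6 ∷ 3 ∷ 7 ∷ 1 ∷ 6 ∷ 9 ∷ 5 ∷ 0 ∷ 3 ∷ 9 ∷ 9 ∷ 3 ∷ 4 ∷ 8 ∷ 6 ∷ 5 ∷ 4 ∷ 5 ∷ 9 ∷ 2 ∷ 0 ∷ 5 ∷ 6 ∷
  7 ∷ 7 ∷ 9 ∷ 6 ∷ 1 ∷ 4 ∷ 6 ∷ 4 ∷ 0 ∷ 2 ∷ 6 ∷ 7 ∷ 1 ∷ 9 ∷ 7 ∷ 7 ∷ 0 ∷ 8 ∷ 3 ∷ 6 ∷ 3 ∷ 8 ∷ 1 ∷ 5 ∷ 7 ∷ 2 ∷ 8 ∷ 0 ∷ 5 ∷ 4 ∷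
  1 ∷ 3 ∷ 9 ∷ 4 ∷ 6 ∷ 7 ∷ 5 ∷ 9 ∷ 9 ∷ 5 ∷ 7 ∷ []
  where
  open import Agda.Builtin.FromNat using (Number; fromNat)
  open import Data.Unit using (⊤; tt)
  -- Fin literals carry the constraint True (m <? 10), which reduces to ⊤.
  instance
    numberColour : Number Colour
    numberColour = number _
    unit : ⊤
    unit = tt

colours-noMonochromaticTriple : ∀ {d} → d < length colours → NoMonochromaticTriple (suc d) colours
colours-noMonochromaticTriple =
  toWitness {a? = allUpTo? (λ d → noMonochromaticTriple? _≟_ (suc d) colours) (length colours)} _

mainTheorem4 : Σ (Colouring 10) λ c → ¬ HasMonoAP 10 3 701 c
mainTheorem4 = listColouring colours , noMonoAP-listColouring colours colours-noMonochromaticTriple
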